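{- Let $G$ be a graph of order $n\geq 1$ and maximum degree $\Delta\geq 0$. Then $$\max(n+1,\,2(\Delta+1))\leq \lambda(M(G))\leq (n+1)+\lambda(G).$$
   Context: All graphs are finite, simple and undirected. An $L(2,1)$-labeling of a graph $G=(V,E)$ is a function $f:V\to\{0,1,2,\dots\}$ such that $|f(x)-f(y)|\geq 2$ whenever $d_G(x,y)=1$ and $|f(x)-f(y)|\geq 1$ whenever $d_G(x,y)=2$. The $L(2,1)$-labeling number $\lambda(G)$ is the smallest $k$ such that $G$ has an $L(2,1)$-labeling with all labels in $\{0,\dots,k\}$. For $G$ with $V=\{v_1,\dots,v_n\}$, the Mycielski graph $M(G)$ has vertex set $V\cup V'\cup\{u\}$ with $V'=\{v_1',\dots,v_n'\}$, and edge set $E\cup\{v_iv_j' : v_iv_j\in E\}\cup\{v_i'u: 1\le i\le n\}$. -}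

module Defs where

open import Data.Nat using (ℕ; zero; suc; _+_; _*_; _≤_; _⊔_; ∣_-_∣)
open import Data.Fin using (Fin)
open import Data.Bool using (Bool; true; false)
open import Data.List using (List; map; foldr; filter; length; allFin)
open import Data.Product using (Σ; ∃; _×_; _,_)
open import Relation.Nullary using (¬_)
open import Relation.Binary.PropositionalEquality using (_≡_; refl)
open import Data.Bool.Properties using (T?)

record Graph (V : Set) : Set where
  field
    adj     : V → V → Bool
    adj-sym : ∀ x y → adj x y ≡ adj y x
    adj-irr : ∀ x → adj x x ≡ false
open Graph public

Dist1 : {V : Set} → Graph V → V → V → Set
Dist1 G x y = adj G x y ≡ true

Dist2 : {V : Set} → Graph V → V → V → Set
Dist2 G x y = ¬ (x ≡ y) × (adj G x y ≡ false)
              × (∃ λ z → (adj G x z ≡ true) × (adj G z y ≡ true))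

IsL21 : {V : Set} → Graph V → (V → ℕ) → Set
IsL21 G f = (∀ x y → Dist1 G x y → 2 ≤ ∣ f x - f y ∣)
          × (∀ x y → Dist2 G x y → 1 ≤ ∣ f x - f y ∣)

HasL21Span : {V : Set} → Graph V → ℕ → Set
HasL21Span G k = Σ _ λ f → IsL21 G f × (∀ x → f x ≤ k)

IsLambda : {V : Set} → Graph V → ℕ → Set
IsLambda G k = HasL21Span G k × (∀ j → HasL21Span G j → k ≤ j)

degree : {n : ℕ} → Graph (Fin n) → Fin n → ℕ
degree {n} G v = length (filter (λ w → T? (adj G v w)) (allFin n))

maxDegree : {n : ℕ} → Graph (Fin n) → ℕ
maxDegree {n} G = foldr _⊔_ 0 (map (degree G) (allFin n))

data MV (n : ℕ) : Set where
  orig : Fin n → MV n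
  copy : Fin n → MV n
  apex : MV n

myAdj : {n : ℕ} → Graph (Fin n) → MV n → MV n → Bool
myAdj G (orig i) (orig j) = adj G i j
myAdj G (orig i) (copy j) = adj G i j
myAdj G (copy i) (orig j) = adj G i j
myAdj G (copy i) (copy j) = false
myAdj G (copy i) apex     = true
myAdj G apex     (copy j) = true
myAdj G (orig i) apex     = false
myAdj G apex     (orig j) = false
myAdj G apex     apex     = false

myAdj-sym : {n : ℕ} (G : Graph (Fin n)) → ∀ x y → myAdj G x y ≡ myAdj G y x
myAdj-sym G (orig i) (orig j) = adj-sym G i j
myAdj-sym G (orig i) (copy j) = adj-sym G i j
myAdj-sym G (copy i) (orig j) = adj-sym G i j
myAdj-sym G (copy i) (copy j) = refl
myAdj-sym G (copy i) apex     = refl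
myAdj-sym G apex     (copy j) = refl
myAdj-sym G (orig i) apex     = refl
myAdj-sym G apex     (orig j) = refl
myAdj-sym G apex     apex     = refl

myAdj-irr : {n : ℕ} (G : Graph (Fin n)) → ∀ x → myAdj G x x ≡ false
myAdj-irr G (orig i) = adj-irr G i
myAdj-irr G (copy i) = refl
myAdj-irr G apex     = refl

Mycielski : {n : ℕ} → Graph (Fin n) → Graph (MV n)
Mycielski G = record { adj = myAdj G ; adj-sym = myAdj-sym G ; adj-irr = myAdj-irr G }

-- The copies v′ together with the apex u are pairwise within distance two, and the labels next to
-- that of u are used neither by u nor by its neighbours; so n + 1 distinct labels and one gap fit into
-- {0,…,λ(M(G))}. For a vertex v of maximum degree Δ ≥ 1 the 2Δ + 3 vertices v, v′, u, N(v), N(v)′ are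
-- pairwise within distance two as well. Conversely, an optimal labelling f of G extends to M(G):
-- keep f + 1 on V, put 0 on u, and give the copies the distinct labels λ(G) + 2, …, λ(G) + n + 1,
-- the smallest one to the copy of a vertex labelled λ(G), whose neighbours carry labels ≤ λ(G) − 2.
module Submission where

open import Defs
open import Data.Nat using (ℕ; zero; suc; _+_; _∸_; _*_; _⊔_; _≤_; _<_; _<?_; _≟_; ∣_-_∣; s≤s; z≤n)
open import Data.Nat.Properties
open import Data.Nat.Tactic.RingSolver using (solve-∀)
import Data.Fin as F
open import Data.Fin using (Fin; toℕ; fromℕ<; punchOut; splitAt; join) renaming (zero to fzero; suc to fsuc)
open import Data.Fin.Properties
  using (injective⇒≤; fromℕ<-injective; punchOut-injective; join-splitAt; toℕ-injective; toℕ≤pred[n]; any?)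
open import Data.Fin.Permutation.Components using (transpose; transpose-inverse)
open import Data.Vec.Functional using (Vector; _∷_; _++_)
open import Data.Vec.Functional.Relation.Unary.All using (All)
open import Data.Vec.Functional.Relation.Unary.All.Properties using (++⁺)
open import Data.List using (List; map; filter; allFin; lookup)
import Data.List.Relation.Unary.All as ListAll
import Data.List.Relation.Unary.AllPairs as AllPairs
open import Data.List.Relation.Unary.Unique.Propositional using (Unique)
import Data.List.Relation.Unary.Unique.Propositional.Properties as Unique
open import Data.List.Membership.Propositional.Properties using (∈-lookup; ∈-filter⁻; ∈-map⁻; foldr-selective)
open import Data.Product using (∃; _×_; _,_; proj₁; proj₂)
open import Data.Sum using (_⊎_; inj₁; inj₂)
open import Data.Bool using (true; false)
open import Data.Bool.Properties using (T?; T-≡)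
open import Function using (_∘_; id; Equivalence)
open import Function.Definitions using (Injective)
open import Relation.Binary.Definitions using (Symmetric)
open import Relation.Nullary using (yes; no; contradiction)
open import Relation.Nullary.Decidable using (dec-true)
open import Relation.Binary.PropositionalEquality

separated⇒≢ : ∀ {a b} → 1 ≤ ∣ a - b ∣ → a ≢ b
separated⇒≢ {a} sep refl = contradiction (subst (1 ≤_) (∣n-n∣≡0 a) sep) λ ()

≢⇒1≤∣-∣ : ∀ {a b} → a ≢ b → 1 ≤ ∣ a - b ∣
≢⇒1≤∣-∣ a≢b = n≢0⇒n>0 (a≢b ∘ ∣m-n∣≡0⇒m≡n)

∣1+n-n∣≡1 : ∀ n → ∣ suc n - n ∣ ≡ 1
∣1+n-n∣≡1 zero    = refl
∣1+n-n∣≡1 (suc n) = ∣1+n-n∣≡1 n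

+≤⇒≤∣-∣ : ∀ {a b k} → k + a ≤ b → k ≤ ∣ a - b ∣
+≤⇒≤∣-∣ {a} {b} {k} k+a≤b = begin
  k            ≡⟨ m+n∸n≡m k a ⟨
  k + a ∸ a    ≤⟨ ∸-monoˡ-≤ a k+a≤b ⟩
  b ∸ a        ≡⟨ m≤n⇒∣m-n∣≡n∸m (≤-trans (m≤n+m a k) k+a≤b) ⟨
  ∣ a - b ∣    ∎
  where open ≤-Reasoning

≤∣-∣⇒+≤ : ∀ {a b k} → a ≤ b → k ≤ ∣ a - b ∣ → k + a ≤ b
≤∣-∣⇒+≤ {a} {b} {k} a≤b k≤∣a-b∣ = begin
  k + a            ≤⟨ +-monoˡ-≤ a k≤∣a-b∣ ⟩
  ∣ a - b ∣ + a    ≡⟨ cong (_+ a) (m≤n⇒∣m-n∣≡n∸m a≤b) ⟩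
  b ∸ a + a        ≡⟨ m∸n+n≡m a≤b ⟩
  b                ∎
  where open ≤-Reasoning

Pairwise : ∀ {A : Set} {k} → (A → A → Set) → Vector A k → Set
Pairwise R xs = ∀ {i j} → i ≢ j → R (xs i) (xs j)

∷-pairwise : ∀ {A : Set} {R : A → A → Set} {k x} {xs : Vector A k} →
             Symmetric R → All (R x) xs → Pairwise R xs → Pairwise R (x ∷ xs)
∷-pairwise R-sym Rx Rxs {fzero}  {fzero}  0≢0 = contradiction refl 0≢0
∷-pairwise R-sym Rx Rxs {fzero}  {fsuc j} _   = Rx j
∷-pairwise R-sym Rx Rxs {fsuc i} {fzero}  _   = R-sym (Rx i)
∷-pairwise R-sym Rx Rxs {fsuc i} {fsuc j} i≢j = Rxs (i≢j ∘ cong fsuc)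

splitAt-injective : ∀ m {n} {i j : Fin (m + n)} → splitAt m i ≡ splitAt m j → i ≡ j
splitAt-injective m {n} {i} {j} eq = begin
  i                       ≡⟨ join-splitAt m n i ⟨
  join m n (splitAt m i)  ≡⟨ cong (join m n) eq ⟩
  join m n (splitAt m j)  ≡⟨ join-splitAt m n j ⟩
  j                       ∎
  where open ≡-Reasoning

++-pairwise : ∀ {A : Set} {R : A → A → Set} {m n} {xs : Vector A m} {ys : Vector A n} →
              Symmetric R → Pairwise R xs → Pairwise R ys → (∀ i j → R (xs i) (ys j)) →
              Pairwise R (xs ++ ys)
++-pairwise {m = m} R-sym Rxs Rys Rxy {i} {j} i≢j with splitAt m i in eqi | splitAt m j in eqj
... | inj₁ a | inj₁ b = Rxs λ a≡b → i≢j (splitAt-injective m (trans eqi (trans (cong inj₁ a≡b) (sym eqj))))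
... | inj₁ a | inj₂ b = Rxy a b
... | inj₂ a | inj₁ b = R-sym (Rxy b a)
... | inj₂ a | inj₂ b = Rys λ a≡b → i≢j (splitAt-injective m (trans eqi (trans (cong inj₂ a≡b) (sym eqj))))

∘-distinct : ∀ {A B : Set} {k} {g : A → B} {xs : Vector A k} →
             Injective _≡_ _≡_ g → Pairwise _≢_ xs → Pairwise _≢_ (g ∘ xs)
∘-distinct g-injective xs-distinct i≢j = xs-distinct i≢j ∘ g-injective

pairwise-≢⇒injective : ∀ {A : Set} {k} {g : Vector A k} → Pairwise _≢_ g → Injective _≡_ _≡_ g
pairwise-≢⇒injective g-distinct {i} {j} gi≡gj with i F.≟ j
... | yes i≡j = i≡j
... | no  i≢j = contradiction gi≡gj (g-distinct i≢j)

unique⇒lookup-distinct : ∀ {A : Set} {xs : List A} → Unique xs → Pairwise _≢_ (lookup xs)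
unique⇒lookup-distinct (x∉xs AllPairs.∷ _)         {fzero}  {fzero}  0≢0 = contradiction refl 0≢0
unique⇒lookup-distinct (x∉xs AllPairs.∷ _)         {fzero}  {fsuc j} _   = ListAll.lookup x∉xs (∈-lookup j)
unique⇒lookup-distinct (x∉xs AllPairs.∷ _)         {fsuc i} {fzero}  _   = ≢-sym (ListAll.lookup x∉xs (∈-lookup i))
unique⇒lookup-distinct (_    AllPairs.∷ xs-unique) {fsuc i} {fsuc j} i≢j =
  unique⇒lookup-distinct xs-unique (i≢j ∘ cong fsuc)

-- Punching the missing value m out of {0,…,L} injects the labels into Fin L.
distinct-avoiding⇒≤ : ∀ {k L m} (g : Vector ℕ k) → Pairwise _≢_ g →
                      All (_≤ L) g → All (_≢ m) g → m ≤ L → k ≤ L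
distinct-avoiding⇒≤ {k} {L} {m} g g-distinct g≤L g≢m m≤L = injective⇒≤ slot-injective
  where
    gap≢value : ∀ i → fromℕ< (s≤s m≤L) ≢ fromℕ< (s≤s (g≤L i))
    gap≢value i eq = g≢m i (sym (fromℕ<-injective _ _ _ _ eq))
    slot : Fin k → Fin L
    slot i = punchOut (gap≢value i)
    slot-injective : Injective _≡_ _≡_ slot
    slot-injective eq = pairwise-≢⇒injective g-distinct
      (fromℕ<-injective _ _ _ _ (punchOut-injective (gap≢value _) (gap≢value _) eq))

module _ {V : Set} (G : Graph V) where

  dist1-sym : ∀ {x y} → Dist1 G x y → Dist1 G y x
  dist1-sym {x} {y} xy = trans (adj-sym G y x) xy

  dist1⇒≢ : ∀ {x y} → Dist1 G x y → x ≢ y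
  dist1⇒≢ {x} xx refl with trans (sym xx) (adj-irr G x)
  ... | ()

  data Near (x y : V) : Set where
    adjacent         : Dist1 G x y → Near x y
    common-neighbour : ∀ z → x ≢ y → Dist1 G z x → Dist1 G z y → Near x y

  near-sym : Symmetric Near
  near-sym (adjacent xy)                   = adjacent (dist1-sym xy)
  near-sym (common-neighbour z x≢y zx zy) = common-neighbour z (x≢y ∘ sym) zy zx

  adjacent⇒label≢ : ∀ {f x y} → IsL21 G f → Dist1 G x y → f x ≢ f y
  adjacent⇒label≢ (sep₁ , _) xy = separated⇒≢ (≤-trans (s≤s z≤n) (sep₁ _ _ xy))

  near⇒label≢ : ∀ {f x y} → IsL21 G f → Near x y → f x ≢ f y
  near⇒label≢ f-L21 (adjacent xy) = adjacent⇒label≢ f-L21 xy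
  near⇒label≢ {x = x} {y} f-L21 (common-neighbour z x≢y zx zy) with adj G x y in xy
  ... | true  = adjacent⇒label≢ f-L21 xy
  ... | false = separated⇒≢ (proj₂ f-L21 x y (x≢y , xy , z , dist1-sym zx , zy))

  star-pairwise : ∀ {k c} {S : Vector V k} → All (Dist1 G c) S → Pairwise _≢_ S → Pairwise Near (c ∷ S)
  star-pairwise {c = c} {S} cS S-distinct =
    ∷-pairwise {x = c} {xs = S} near-sym (adjacent ∘ cS) λ i≢j → common-neighbour c (S-distinct i≢j) (cS _) (cS _)

  module _ {f L} (f-L21 : IsL21 G f) (f≤L : ∀ x → f x ≤ L) where

    near-labels-distinct : ∀ {k} {S : Vector V k} → Pairwise Near S → Pairwise _≢_ (f ∘ S)
    near-labels-distinct S-near = near⇒label≢ {f = f} f-L21 ∘ S-near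

    near-clique-bound : ∀ {k} (S : Vector V k) → Pairwise Near S → k ≤ suc L
    near-clique-bound S S-near = distinct-avoiding⇒≤ (f ∘ S)
      (near-labels-distinct S-near) (m≤n⇒m≤1+n ∘ f≤L ∘ S) (λ i → <⇒≢ (s≤s (f≤L (S i)))) ≤-refl

    adjacent-value-in-range : ∀ {c y} → Dist1 G c y → ∃ λ m → m ≤ L × ∣ f c - m ∣ ≡ 1
    adjacent-value-in-range {c} {y} cy with f c in fc
    ... | suc a = a , ≤-trans (n≤1+n a) (subst (_≤ L) fc (f≤L c)) , ∣1+n-n∣≡1 a
    ... | zero  = 1 , <⇒≤ (≤-trans (subst (2 ≤_) (cong (∣_- f y ∣) fc) (proj₁ f-L21 c y cy)) (f≤L y)) , refl

    star-bound : ∀ {k c} (S : Vector V (suc k)) → All (Dist1 G c) S → Pairwise _≢_ S → suc (suc k) ≤ L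
    star-bound {c = c} S cS S-distinct with adjacent-value-in-range (cS fzero)
    ... | m , m≤L , gap = distinct-avoiding⇒≤ (f ∘ (c ∷ S))
      (near-labels-distinct (star-pairwise cS S-distinct)) (f≤L ∘ (c ∷ S)) avoids m≤L
      where
        avoids : All (_≢ m) (f ∘ (c ∷ S))
        avoids fzero    refl = contradiction (trans (sym gap) (∣n-n∣≡0 m)) λ ()
        avoids (fsuc i) refl = contradiction (subst (2 ≤_) gap (proj₁ f-L21 c (S i) (cS i))) λ { (s≤s ()) }

module _ {n : ℕ} (G : Graph (Fin n)) where

  neighbours : (v : Fin n) → Vector (Fin n) (degree G v)
  neighbours v = lookup (filter (λ w → T? (adj G v w)) (allFin n))

  neighbours-adjacent : ∀ v → All (Dist1 G v) (neighbours v)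
  neighbours-adjacent v i =
    Equivalence.to T-≡ (proj₂ (∈-filter⁻ (λ w → T? (adj G v w)) {xs = allFin n} (∈-lookup i)))

  neighbours-distinct : ∀ v → Pairwise _≢_ (neighbours v)
  neighbours-distinct v = unique⇒lookup-distinct (Unique.filter⁺ (λ w → T? (adj G v w)) (Unique.allFin⁺ n))

  maxDegree-attained : maxDegree G ≡ 0 ⊎ ∃ λ v → maxDegree G ≡ degree G v
  maxDegree-attained with foldr-selective ⊔-sel 0 (map (degree G) (allFin n))
  ... | inj₁ Δ≡0 = inj₁ Δ≡0
  ... | inj₂ Δ∈  with ∈-map⁻ (degree G) Δ∈
  ...   | v , _ , Δ≡dv = inj₂ (v , Δ≡dv)

orig-injective : ∀ {n} → Injective _≡_ _≡_ (orig {n})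
orig-injective refl = refl

copy-injective : ∀ {n} → Injective _≡_ _≡_ (copy {n})
copy-injective refl = refl

module _ {n : ℕ} (G : Graph (Fin n)) {f L} (f-L21 : IsL21 (Mycielski G) f) (f≤L : ∀ x → f x ≤ L) where

  private
    M = Mycielski G

  neighbourhood-bound : ∀ v → 0 < degree G v → 3 + (degree G v + degree G v) ≤ suc L
  neighbourhood-bound v 0<d = near-clique-bound M f-L21 f≤L
    (copy v ∷ apex ∷ orig v ∷ ring)
    (∷-pairwise {R = Near M} {x = copy v} {xs = apex ∷ orig v ∷ ring} (near-sym M) copy-v-near
      (∷-pairwise {R = Near M} {x = apex} {xs = orig v ∷ ring} (near-sym M) apex-near
        (star-pairwise M {c = orig v} {S = ring} ring-adjacent ring-distinct)))
    where
      N = neighbours G v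
      N-adjacent = neighbours-adjacent G v
      v~w₀ : Dist1 G v (N (fromℕ< 0<d))
      v~w₀ = N-adjacent _
      ring : Vector (MV n) (degree G v + degree G v)
      ring = orig ∘ N ++ copy ∘ N
      ring-adjacent : All (Dist1 M (orig v)) ring
      ring-adjacent = ++⁺ (Dist1 M (orig v)) {xs = orig ∘ N} N-adjacent N-adjacent
      ring-distinct : Pairwise _≢_ ring
      ring-distinct = ++-pairwise {R = _≢_} ≢-sym
        (∘-distinct orig-injective (neighbours-distinct G v))
        (∘-distinct copy-injective (neighbours-distinct G v)) λ _ _ ()
      copy-v-near : All (Near M (copy v)) (apex ∷ orig v ∷ ring)
      copy-v-near fzero           = adjacent refl
      copy-v-near (fsuc fzero)    = common-neighbour (orig _) (λ ()) (dist1-sym G v~w₀) (dist1-sym G v~w₀)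
      copy-v-near (fsuc (fsuc k)) = ++⁺ (Near M (copy v)) {xs = orig ∘ N}
        (adjacent ∘ N-adjacent)
        (λ i → common-neighbour apex (dist1⇒≢ G (N-adjacent i) ∘ copy-injective) refl refl) k
      apex-near : All (Near M apex) (orig v ∷ ring)
      apex-near fzero    = common-neighbour (copy _) (λ ()) refl (dist1-sym G v~w₀)
      apex-near (fsuc k) = ++⁺ (Near M apex) {xs = orig ∘ N}
        (λ i → common-neighbour (copy v) (λ ()) refl (N-adjacent i))
        (λ _ → adjacent refl) k

  degree-bound : 2 ≤ L → ∀ v → 2 * (degree G v + 1) ≤ L
  degree-bound 2≤L v with 0 <? degree G v
  ... | yes 0<d = ≤-pred (subst (_≤ suc L) (cong suc (sym (2*[m+1]≡2+[m+m] (degree G v))))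
                                (neighbourhood-bound v 0<d))
    where
      2*[m+1]≡2+[m+m] : ∀ m → 2 * (m + 1) ≡ 2 + (m + m)
      2*[m+1]≡2+[m+m] = solve-∀
  ... | no  d≯0 rewrite n≤0⇒n≡0 (≮⇒≥ d≯0) = 2≤L

  maxDegree-bound : 2 ≤ L → 2 * (maxDegree G + 1) ≤ L
  maxDegree-bound 2≤L with maxDegree-attained G
  ... | inj₁ Δ≡0        rewrite Δ≡0  = 2≤L
  ... | inj₂ (v , Δ≡dv) rewrite Δ≡dv = degree-bound 2≤L v

Mycielski-order-bound : ∀ {n} (G : Graph (Fin (suc n))) {f L} →
                        IsL21 (Mycielski G) f → (∀ x → f x ≤ L) → suc (suc n) ≤ L
Mycielski-order-bound G f-L21 f≤L =
  star-bound (Mycielski G) f-L21 f≤L {c = apex} copy (λ _ → refl) (∘-distinct copy-injective id)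

span-attained : ∀ {n} {G : Graph (Fin (suc n))} {l f} → IsLambda G l → IsL21 G f → (∀ i → f i ≤ l) →
                ∃ λ i → f i ≡ l
span-attained {l = zero}  _ _ f≤0 = fzero , n≤0⇒n≡0 (f≤0 fzero)
span-attained {l = suc k} {f} (_ , minimal) f-L21 f≤l with any? (λ i → f i ≟ suc k)
... | yes attained  = attained
... | no  ¬attained = contradiction (minimal k (f , f-L21 , f≤k)) (<-irrefl refl)
  where
    f≤k : ∀ i → f i ≤ k
    f≤k i = ≤-pred (≤∧≢⇒< (f≤l i) (¬attained ∘ (i ,_)))

module Extension {n} (G : Graph (Fin (suc n))) {f l} (f-L21 : IsL21 G f) (f≤l : ∀ i → f i ≤ l)
                 (top : Fin (suc n)) (f-top : f top ≡ l) where

  rank : Fin (suc n) → ℕ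
  rank i = toℕ (transpose top fzero i)

  rank-top : rank top ≡ 0
  rank-top rewrite dec-true (top F.≟ top) refl = refl

  rank-injective : ∀ {i j} → rank i ≡ rank j → i ≡ j
  rank-injective {i} {j} eq = begin
    i                                           ≡⟨ transpose-inverse fzero top ⟨
    transpose fzero top (transpose top fzero i) ≡⟨ cong (transpose fzero top) (toℕ-injective eq) ⟩
    transpose fzero top (transpose top fzero j) ≡⟨ transpose-inverse fzero top ⟩
    j                                           ∎
    where open ≡-Reasoning

  extension : MV (suc n) → ℕ
  extension (orig i) = suc (f i)
  extension (copy i) = 2 + l + rank i
  extension apex     = 0

  orig<copy : ∀ i j → extension (orig i) < extension (copy j)
  orig<copy i j = s≤s (s≤s (≤-trans (f≤l i) (m≤m+n l (rank j))))

  adjacent-orig-copy-gap : ∀ {i j} → Dist1 G i j → suc (f i) ≤ l + rank j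
  adjacent-orig-copy-gap {i} {j} ij with rank j in rank-j
  ... | suc r = ≤-trans (s≤s (≤-trans (f≤l i) (m≤m+n l r))) (≤-reflexive (sym (+-suc l r)))
  ... | zero  = ≤-trans (n≤1+n _) (≤-trans 2+fi≤l (≤-reflexive (sym (+-identityʳ l))))
    where
      j≡top : j ≡ top
      j≡top = rank-injective (trans rank-j (sym rank-top))
      2+fi≤l : 2 + f i ≤ l
      2+fi≤l = subst (2 + f i ≤_) f-top
        (≤∣-∣⇒+≤ (subst (f i ≤_) (sym f-top) (f≤l i)) (proj₁ f-L21 i top (subst (Dist1 G i) j≡top ij)))

  adjacent-separated : ∀ x y → Dist1 (Mycielski G) x y → 2 ≤ ∣ extension x - extension y ∣
  adjacent-separated (orig i) (orig j) ij = proj₁ f-L21 i j ij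
  adjacent-separated (orig i) (copy j) ij = +≤⇒≤∣-∣ (s≤s (s≤s (adjacent-orig-copy-gap ij)))
  adjacent-separated (copy i) (orig j) ij = subst (2 ≤_) (∣-∣-comm (extension (orig j)) (extension (copy i)))
    (+≤⇒≤∣-∣ (s≤s (s≤s (adjacent-orig-copy-gap (dist1-sym G ij)))))
  adjacent-separated (copy i) apex     _  = s≤s (s≤s z≤n)
  adjacent-separated apex     (copy j) _  = s≤s (s≤s z≤n)

  distance2-separated : ∀ x y → Dist2 (Mycielski G) x y → 1 ≤ ∣ extension x - extension y ∣
  distance2-separated (orig i) (orig j) (x≢y , ¬ij , orig k , ik , kj) =
    proj₂ f-L21 i j (x≢y ∘ cong orig , ¬ij , k , ik , kj)
  distance2-separated (orig i) (orig j) (x≢y , ¬ij , copy k , ik , kj) =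
    proj₂ f-L21 i j (x≢y ∘ cong orig , ¬ij , k , ik , kj)
  distance2-separated (orig i) (copy j) _ = +≤⇒≤∣-∣ (orig<copy i j)
  distance2-separated (copy i) (orig j) _ = subst (1 ≤_) (∣-∣-comm (extension (orig j)) (extension (copy i)))
    (+≤⇒≤∣-∣ (orig<copy j i))
  distance2-separated (copy i) (copy j) (x≢y , _) =
    ≢⇒1≤∣-∣ (x≢y ∘ cong copy ∘ rank-injective ∘ +-cancelˡ-≡ (2 + l) _ _)
  distance2-separated (orig i) apex     _ = s≤s z≤n
  distance2-separated apex     (orig j) _ = s≤s z≤n
  distance2-separated (copy i) apex     _ = s≤s z≤n
  distance2-separated apex     (copy j) _ = s≤s z≤n
  distance2-separated apex     apex     (x≢y , _) = contradiction refl x≢y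

  extension≤ : ∀ x → extension x ≤ 2 + l + n
  extension≤ (orig i) = s≤s (≤-trans (f≤l i) (≤-trans (m≤m+n l n) (n≤1+n _)))
  extension≤ (copy i) = +-monoʳ-≤ (2 + l) (toℕ≤pred[n] _)
  extension≤ apex     = z≤n

Mycielski-span : ∀ {n} (G : Graph (Fin (suc n))) {l} → IsLambda G l → HasL21Span (Mycielski G) (2 + l + n)
Mycielski-span G λG@((f , f-L21 , f≤l) , _) with span-attained {G = G} λG f-L21 f≤l
... | top , f-top = extension , (adjacent-separated , distance2-separated) , extension≤
  where open Extension G f-L21 f≤l top f-top

theorem3p1 : (n : ℕ) → 1 ≤ n → (G : Graph (Fin n)) → (lG lM : ℕ)
    → IsLambda G lG → IsLambda (Mycielski G) lM
    → ((n + 1) ⊔ (2 * (maxDegree G + 1)) ≤ lM) × (lM ≤ (n + 1) + lG)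
theorem3p1 zero    () G
theorem3p1 (suc n) _  G lG lM λG ((f , f-L21 , f≤lM) , minimal) =
  ⊔-lub (subst (_≤ lM) (+-comm 1 (suc n)) order-bound) (maxDegree-bound G f-L21 f≤lM 2≤lM) ,
  subst (lM ≤_) (2+l+n≡[1+n+1]+l n lG) (minimal _ (Mycielski-span G λG))
  where
    order-bound : suc (suc n) ≤ lM
    order-bound = Mycielski-order-bound G f-L21 f≤lM
    2≤lM : 2 ≤ lM
    2≤lM = ≤-trans (s≤s (s≤s z≤n)) order-bound
    2+l+n≡[1+n+1]+l : ∀ n l → 2 + l + n ≡ (suc n + 1) + l
    2+l+n≡[1+n+1]+l = solve-∀
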